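{- For every integer $t\ge 0$ and every $\sigma\in B_t$, the length of $\sigma$ is at least $t+3$, and this bound is sharp for all $t$ (i.e. $B_t$ contains a permutation of length $t+3$).
   Context: Sorting procedure: a permutation $\pi$ is processed using an input sequence (initially $\pi_1,\ldots,\pi_n$), a stack and an output. Let $m$ be the smallest value not yet output. At each step: if the stack's top entry equals $m$, pop it to the output; otherwise, if the input is nonempty, push the next input entry onto the stack. When no move is possible and the stack is nonempty, the remaining stack entries are returned to the input in the reverse of their order in the previous input (i.e. listed from top of stack to bottom), and the procedure is repeated. The rev-tier $t_{\operatorname{rev}}(\pi)$ is the number of times entries must be returned to the input before the output is $1,2,\ldots,n$. The permutations of rev-tier at most $t$ form a permutation class; $B_t$ denotes its basis (the minimal permutations, under pattern containment, of rev-tier greater than $t$). -}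

module Defs where

open import Data.Nat using (ℕ; zero; suc; _<_; _≤_; _>_; _≡ᵇ_)
open import Data.Bool using (if_then_else_)
open import Data.List using (List; []; _∷_; length; lookup; applyUpTo)
open import Data.List.Relation.Binary.Sublist.Propositional using (_⊆_)
open import Data.List.Relation.Binary.Permutation.Propositional using (_↭_)
open import Data.Fin using (Fin; cast)
open import Data.Product using (Σ; ∃; _×_; _,_)
open import Relation.Binary.PropositionalEquality using (_≡_)

IsPerm : List ℕ → Set
IsPerm π = π ↭ applyUpTo suc (length π)

OrdIso : List ℕ → List ℕ → Set
OrdIso xs ys = Σ (length xs ≡ length ys) λ eq →
  ∀ (i j : Fin (length xs)) →
    (lookup xs i < lookup xs j → lookup ys (cast eq i) < lookup ys (cast eq j)) ×
    (lookup ys (cast eq i) < lookup ys (cast eq j) → lookup xs i < lookup xs j)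

Contains : List ℕ → List ℕ → Set
Contains π τ = ∃ λ ρ → (ρ ⊆ π) × OrdIso ρ τ

-- The sorting procedure.  Stacks are lists with the head being the top.
-- m is the smallest value not yet output.
-- Pop while the top of the stack equals m.
popAll : List ℕ → ℕ → List ℕ × ℕ
popAll [] m = [] , m
popAll (y ∷ s) m = if y ≡ᵇ m then popAll s (suc m) else (y ∷ s , m)

passGo : List ℕ → List ℕ → ℕ → List ℕ × ℕ
passGo [] s m = s , m
passGo (x ∷ xs) s m with popAll (x ∷ s) m
... | s' , m' = passGo xs s' m'

pass : List ℕ → ℕ → List ℕ × ℕ
pass inp m = passGo inp [] m

-- When the stack is nonempty at the end of
-- a pass, its entries (read top to bottom) form the new input.
-- The fuel argument bounds the number of passes; each pass outputs at least
-- one entry, so fuel (suc (length π)) is always sufficient.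
countReturns : ℕ → List ℕ → ℕ → ℕ
countReturns zero inp m = zero
countReturns (suc f) inp m with pass inp m
... | [] , _ = zero
... | (y ∷ s) , m' = suc (countReturns f (y ∷ s) m')

revTier : List ℕ → ℕ
revTier π = countReturns (suc (length π)) π 1

InBasis : ℕ → List ℕ → Set
InBasis t σ = IsPerm σ × revTier σ > t ×
  (∀ τ → IsPerm τ → Contains σ τ → length τ < length σ → revTier τ ≤ t)

module Submission where

-- Call a list Consecutive from m if it is a rearrangement of
-- m, m+1, …, m+|l|−1.  During one pass, "remaining input ++ stack" stays
-- Consecutive from the current m, every pop moves one entry out of the
-- configuration while incrementing m, and the first pass of a nonempty
-- input outputs at least the entry m.  A stack left over at the end of a
-- pass is blocked (its top is not m), so it has at least two entries.
-- Hence each return shrinks the input by at least one while keeping it of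
-- length at least two, and a permutation of length n has rev-tier at most
-- n − 2.  A basis element has rev-tier > t, so its length is ≥ t + 3.
--
-- The "zigzag" permutation (e.g. 2 4 5 3 1) of length L + 3
-- survives a pass as the zigzag of length L + 2, so its rev-tier is at
-- least L + 1; all its proper patterns have rev-tier ≤ L by the bound above.

open import Defs
open import Data.Nat using (ℕ; _+_; _≤_)
open import Data.List using (List; length)
open import Data.Product using (_×_; ∃)
open import Relation.Binary.PropositionalEquality using (_≡_)

open import Data.Nat using (zero; suc; _<_; _>_; _∸_; _≡ᵇ_; z≤n; s≤s)
open import Data.Nat.Properties
open import Data.Bool using (true; false; T)
open import Data.Unit using (tt; ⊤)
open import Data.Empty using (⊥-elim)
open import Data.Sum using (inj₁; inj₂)
open import Data.List using ([]; _∷_; _++_; [_]; reverse; applyUpTo)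
open import Data.List.Properties
  using (length-++; length-reverse; reverse-++; reverse-involutive; unfold-reverse; ++-identityʳ; ++-assoc)
open import Data.List.Relation.Unary.All as All using (All; []; _∷_)
open import Data.List.Relation.Unary.Any using (here; there)
open import Data.List.Membership.Propositional using (_∈_)
open import Data.List.Relation.Binary.Permutation.Propositional using (_↭_; ↭-sym; ↭-trans; ↭-refl; prep)
open import Data.List.Relation.Binary.Permutation.Propositional.Properties
  using (↭-length; shift; drop-∷; ∈-resp-↭; All-resp-↭; ++-comm; ↭-reverse)
open import Data.Product using (_,_)
open import Relation.Binary.PropositionalEquality using (refl; sym; trans; cong; cong₂; subst; module ≡-Reasoning)
open import Relation.Nullary using (¬_)

≡ᵇ-true : ∀ {y m} → (y ≡ᵇ m) ≡ true → y ≡ m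
≡ᵇ-true {y} {m} e = ≡ᵇ⇒≡ y m (subst T (sym e) tt)

≡ᵇ-false : ∀ {y m} → (y ≡ᵇ m) ≡ false → ¬ (y ≡ m)
≡ᵇ-false {y} {m} e y≡m = subst T e (≡⇒≡ᵇ y m y≡m)

range : ℕ → ℕ → List ℕ
range m zero = []
range m (suc n) = m ∷ range (suc m) n

applyUpTo≡range : ∀ n (f : ℕ → ℕ) m → (∀ i → f i ≡ m + i) → applyUpTo f n ≡ range m n
applyUpTo≡range zero f m f≗m+ = refl
applyUpTo≡range (suc n) f m f≗m+ =
  cong₂ _∷_ (trans (f≗m+ 0) (+-identityʳ m))
            (applyUpTo≡range n (λ i → f (suc i)) (suc m) (λ i → trans (f≗m+ (suc i)) (+-suc m i)))

range-lower : ∀ m n → All (m ≤_) (range m n)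
range-lower m zero = []
range-lower m (suc n) = ≤-refl ∷ All.map (≤-trans (n≤1+n m)) (range-lower (suc m) n)

Consecutive : List ℕ → ℕ → Set
Consecutive l m = l ↭ range m (length l)

perm⇒consecutive : ∀ π → IsPerm π → Consecutive π 1
perm⇒consecutive π p = subst (π ↭_) (applyUpTo≡range (length π) suc 1 (λ _ → refl)) p

consecutive⇒perm : ∀ π → Consecutive π 1 → IsPerm π
consecutive⇒perm π c = subst (π ↭_) (sym (applyUpTo≡range (length π) suc 1 (λ _ → refl))) c

consecutive-resp-↭ : ∀ {l l' m} → l ↭ l' → Consecutive l m → Consecutive l' m
consecutive-resp-↭ {m = m} l↭l' c =
  subst (λ k → _ ↭ range m k) (↭-length l↭l') (↭-trans (↭-sym l↭l') c)

consecutive-pop : ∀ xs s m → Consecutive (xs ++ m ∷ s) m → Consecutive (xs ++ s) (suc m)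
consecutive-pop xs s m c = drop-∷ (consecutive-resp-↭ (shift m xs s) c)

consecutive-min∈ : ∀ {x xs m} → Consecutive (x ∷ xs) m → m ∈ x ∷ xs
consecutive-min∈ c = ∈-resp-↭ (↭-sym c) (here refl)

consecutive-singleton : ∀ {y m} → Consecutive [ y ] m → y ≡ m
consecutive-singleton c with ∈-resp-↭ (↭-sym c) (here refl)
... | here m≡y = sym m≡y

Blocked : List ℕ → ℕ → Set
Blocked [] m = ⊤
Blocked (y ∷ s) m = ¬ (y ≡ m)

record PopSpec (xs s : List ℕ) (m : ℕ) (s' : List ℕ) (m' : ℕ) : Set where
  field
    consecutive : Consecutive (xs ++ s) m → Consecutive (xs ++ s') m'
    monotone    : m ≤ m'
    conserved   : length s' + m' ≡ length s + m
    blocked     : Blocked s' m'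

popAll-spec : ∀ xs s m {s' m'} → popAll s m ≡ (s' , m') → PopSpec xs s m s' m'
popAll-spec xs [] m refl =
  record { consecutive = λ c → c ; monotone = ≤-refl ; conserved = refl ; blocked = tt }
popAll-spec xs (y ∷ s) m eq with y ≡ᵇ m in e
... | false with refl ← eq =
  record { consecutive = λ c → c ; monotone = ≤-refl ; conserved = refl ; blocked = ≡ᵇ-false e }
... | true with refl ← ≡ᵇ-true {y} {m} e =
  record { consecutive = λ c → R.consecutive (consecutive-pop xs s y c)
         ; monotone = ≤-trans (n≤1+n y) R.monotone
         ; conserved = trans R.conserved (+-suc (length s) y)
         ; blocked = R.blocked }
  where module R = PopSpec (popAll-spec xs s (suc m) eq)

popAll-top : ∀ m s {s' m'} → popAll (m ∷ s) m ≡ (s' , m') → m < m'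
popAll-top m s eq with m ≡ᵇ m in e
... | true = PopSpec.monotone (popAll-spec [] s (suc m) eq)
... | false = ⊥-elim (≡ᵇ-false {m} {m} e refl)

record PassSpec (xs s : List ℕ) (m : ℕ) (s' : List ℕ) (m' : ℕ) : Set where
  field
    consecutive : Consecutive (xs ++ s) m → Consecutive s' m'
    monotone    : m ≤ m'
    conserved   : length s' + m' ≡ length xs + length s + m
    blocked     : Blocked s m → Blocked s' m'
    progress    : m ∈ xs → m < m'

passGo-spec : ∀ xs s m {s' m'} → passGo xs s m ≡ (s' , m') → PassSpec xs s m s' m'
passGo-spec [] s m refl =
  record { consecutive = λ c → c ; monotone = ≤-refl ; conserved = refl
         ; blocked = λ b → b ; progress = λ () }
passGo-spec (x ∷ xs) s m {s'} {m'} eq with popAll (x ∷ s) m in e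
... | s₁ , m₁ =
  record { consecutive = λ c → R.consecutive (P.consecutive (consecutive-resp-↭ (↭-sym (shift x xs s)) c))
         ; monotone = ≤-trans P.monotone R.monotone
         ; conserved = conserved
         ; blocked = λ _ → R.blocked P.blocked
         ; progress = progress }
  where
  module P = PopSpec (popAll-spec xs (x ∷ s) m e)
  module R = PassSpec (passGo-spec xs s₁ m₁ eq)
  open ≡-Reasoning
  conserved : length s' + m' ≡ length (x ∷ xs) + length s + m
  conserved = begin
    length s' + m'                   ≡⟨ R.conserved ⟩
    length xs + length s₁ + m₁       ≡⟨ +-assoc (length xs) (length s₁) m₁ ⟩
    length xs + (length s₁ + m₁)     ≡⟨ cong (length xs +_) P.conserved ⟩
    length xs + (suc (length s) + m) ≡⟨ sym (+-assoc (length xs) (suc (length s)) m) ⟩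
    length xs + suc (length s) + m   ≡⟨ cong (_+ m) (+-suc (length xs) (length s)) ⟩
    suc (length xs + length s) + m   ∎
  -- m is either output when x = m is pushed, or m already increased, or
  -- it is output later in the pass.
  progress : m ∈ x ∷ xs → m < m'
  progress (here refl) = <-≤-trans (popAll-top m s e) R.monotone
  progress (there m∈xs) with m≤n⇒m<n∨m≡n P.monotone
  ... | inj₁ m<m₁ = <-≤-trans m<m₁ R.monotone
  ... | inj₂ refl = R.progress m∈xs

return-shrinks : ∀ k n m m' → suc (suc k) + m' ≡ n + m → m < m' → suc k ≤ n ∸ 2
return-shrinks k n m m' conserved m<m' = ∸-monoˡ-≤ 2 (+-cancelʳ-≤ m (3 + k) n 3+k+m≤n+m)
  where
  open ≤-Reasoning
  3+k+m≤n+m : 3 + k + m ≤ n + m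
  3+k+m≤n+m = begin
    3 + k + m     ≡⟨ sym (cong (2 +_) (+-suc k m)) ⟩
    2 + k + suc m ≤⟨ +-monoʳ-≤ (2 + k) m<m' ⟩
    2 + k + m'    ≡⟨ conserved ⟩
    n + m         ∎

pass-consecutive : ∀ inp m {s' m'} → pass inp m ≡ (s' , m') → Consecutive inp m → Consecutive s' m'
pass-consecutive inp m e c =
  PassSpec.consecutive (passGo-spec inp [] m e) (subst (λ l → Consecutive l m) (sym (++-identityʳ inp)) c)

-- An input Consecutive from m needs at most (length − 2) returns: a
-- returned stack is blocked yet Consecutive, so it cannot have exactly one
-- entry, and it is strictly shorter than the input by progress.
returns-bound : ∀ f inp m → Consecutive inp m → countReturns f inp m ≤ length inp ∸ 2
returns-bound zero inp m c = z≤n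
returns-bound (suc f) [] m c = z≤n
returns-bound (suc f) (x ∷ xs) m c with pass (x ∷ xs) m in e
... | [] , _ = z≤n
... | (y ∷ []) , m' =
  ⊥-elim (PassSpec.blocked (passGo-spec (x ∷ xs) [] m e) tt
                           (consecutive-singleton (pass-consecutive (x ∷ xs) m e c)))
... | (y ∷ z ∷ s) , m' =
  ≤-trans (s≤s (returns-bound f (y ∷ z ∷ s) m' (pass-consecutive (x ∷ xs) m e c)))
          (return-shrinks (length s) (length (x ∷ xs)) m m'
                          (trans F.conserved (cong (_+ m) (+-identityʳ (length (x ∷ xs)))))
                          (F.progress (consecutive-min∈ c)))
  where module F = PassSpec (passGo-spec (x ∷ xs) [] m e)

revTier-bound : ∀ π → IsPerm π → revTier π ≤ length π ∸ 2
revTier-bound π p = returns-bound (suc (length π)) π 1 (perm⇒consecutive π p)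

-- zigzag m L rearranges m, …, m+L−1: it ends in m, preceded by the
-- reversal of zigzag (m+1) (L−1).  For instance zigzag 1 5 = 2 4 5 3 1.
zigzag : ℕ → ℕ → List ℕ
zigzag m zero = []
zigzag m (suc L) = reverse (zigzag (suc m) L) ++ [ m ]

reverse-zigzag : ∀ m L → reverse (zigzag m (suc L)) ≡ m ∷ zigzag (suc m) L
reverse-zigzag m L = trans (reverse-++ (reverse (zigzag (suc m) L)) [ m ])
                           (cong (m ∷_) (reverse-involutive (zigzag (suc m) L)))

zigzag-head : ∀ m L → zigzag m (suc (suc L)) ≡ suc m ∷ (zigzag (suc (suc m)) L ++ [ m ])
zigzag-head m L = cong (_++ [ m ]) (reverse-zigzag (suc m) L)

zigzag-length : ∀ m L → length (zigzag m L) ≡ L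
zigzag-length m zero = refl
zigzag-length m (suc L) = begin
  length (reverse (zigzag (suc m) L) ++ [ m ]) ≡⟨ length-++ (reverse (zigzag (suc m) L)) ⟩
  length (reverse (zigzag (suc m) L)) + 1      ≡⟨ cong (_+ 1) (length-reverse (zigzag (suc m) L)) ⟩
  length (zigzag (suc m) L) + 1                ≡⟨ cong (_+ 1) (zigzag-length (suc m) L) ⟩
  L + 1                                        ≡⟨ +-comm L 1 ⟩
  suc L                                        ∎
  where open ≡-Reasoning

zigzag-↭ : ∀ m L → zigzag m L ↭ range m L
zigzag-↭ m zero = ↭-refl
zigzag-↭ m (suc L) = ↭-trans (++-comm (reverse (zigzag (suc m) L)) [ m ])
  (prep m (↭-trans (↭-reverse (zigzag (suc m) L)) (zigzag-↭ (suc m) L)))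

popAll-stuck : ∀ {y m} s → m < y → popAll (y ∷ s) m ≡ (y ∷ s , m)
popAll-stuck {y} {m} s m<y with y ≡ᵇ m in e
... | false = refl
... | true = ⊥-elim (<⇒≢ m<y (sym (≡ᵇ-true {y} {m} e)))

popAll-match : ∀ m s → popAll (m ∷ s) m ≡ popAll s (suc m)
popAll-match m s with m ≡ᵇ m in e
... | true = refl
... | false = ⊥-elim (≡ᵇ-false {m} {m} e refl)

passGo-push : ∀ ys zs s m → All (m <_) ys → passGo (ys ++ zs) s m ≡ passGo zs (reverse ys ++ s) m
passGo-push [] zs s m [] = refl
passGo-push (y ∷ ys) zs s m (m<y ∷ m<ys) with popAll (y ∷ s) m in e
... | s₁ , m₁ with refl ← trans (sym e) (popAll-stuck s m<y) = begin
  passGo (ys ++ zs) (y ∷ s) m          ≡⟨ passGo-push ys zs (y ∷ s) m m<ys ⟩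
  passGo zs (reverse ys ++ [ y ] ++ s) m ≡⟨ cong (λ l → passGo zs l m) (sym (++-assoc (reverse ys) [ y ] s)) ⟩
  passGo zs ((reverse ys ++ [ y ]) ++ s) m ≡⟨ cong (λ l → passGo zs (l ++ s) m) (sym (unfold-reverse y ys)) ⟩
  passGo zs (reverse (y ∷ ys) ++ s) m  ∎
  where open ≡-Reasoning

passGo-singleton : ∀ x s m → passGo [ x ] s m ≡ popAll (x ∷ s) m
passGo-singleton x s m with popAll (x ∷ s) m
... | _ = refl

-- One pass turns the zigzag of length L+3 from m into the zigzag of
-- length L+2 from m+1: everything but m is stacked, m is output, and the
-- stack top m+2 blocks.
pass-zigzag : ∀ m L → pass (zigzag m (3 + L)) m ≡ (zigzag (suc m) (2 + L) , suc m)
pass-zigzag m L = begin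
  passGo (reverse G ++ [ m ]) [] m      ≡⟨ passGo-push (reverse G) [ m ] [] m G-above ⟩
  passGo [ m ] (reverse (reverse G) ++ []) m
    ≡⟨ cong (λ l → passGo [ m ] l m) (trans (++-identityʳ _) (reverse-involutive G)) ⟩
  passGo [ m ] G m                      ≡⟨ passGo-singleton m G m ⟩
  popAll (m ∷ G) m                      ≡⟨ popAll-match m G ⟩
  popAll G (suc m)                      ≡⟨ cong (λ l → popAll l (suc m)) G-head ⟩
  popAll (suc (suc m) ∷ R) (suc m)      ≡⟨ popAll-stuck R ≤-refl ⟩
  (suc (suc m) ∷ R , suc m)             ≡⟨ cong (_, suc m) (sym G-head) ⟩
  (G , suc m)                           ∎
  where
  open ≡-Reasoning
  G = zigzag (suc m) (2 + L)
  R = zigzag (suc (suc (suc m))) L ++ [ suc m ]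
  G-head : G ≡ suc (suc m) ∷ R
  G-head = zigzag-head (suc m) L
  G-above : All (m <_) (reverse G)
  G-above = All-resp-↭ (↭-sym (↭-trans (↭-reverse G) (zigzag-↭ (suc m) (2 + L))))
                       (range-lower (suc m) (2 + L))

returns-step : ∀ f inp m {y s m'} → pass inp m ≡ (y ∷ s , m') →
               countReturns (suc f) inp m ≡ suc (countReturns f (y ∷ s) m')
returns-step f inp m eq rewrite eq = refl

returns-zigzag : ∀ f m L →
  countReturns (suc f) (zigzag m (3 + L)) m ≡ suc (countReturns f (zigzag (suc m) (2 + L)) (suc m))
returns-zigzag f m L =
  trans (returns-step f (zigzag m (3 + L)) m (trans (pass-zigzag m L) (cong (_, suc m) G-head)))
        (cong (λ l → suc (countReturns f l (suc m))) (sym G-head))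
  where
  G-head = zigzag-head (suc m) L

zigzag-returns : ∀ L f m → L ≤ f → L ≤ countReturns (suc f) (zigzag m (2 + L)) m
zigzag-returns zero f m _ = z≤n
zigzag-returns (suc L) (suc f) m (s≤s L≤f) = begin
  suc L                                                     ≤⟨ s≤s (zigzag-returns L f (suc m) L≤f) ⟩
  suc (countReturns (suc f) (zigzag (suc m) (2 + L)) (suc m)) ≡⟨ sym (returns-zigzag (suc f) m L) ⟩
  countReturns (suc (suc f)) (zigzag m (3 + L)) m           ∎
  where open ≤-Reasoning

zigzag-inBasis : ∀ t → InBasis t (zigzag 1 (3 + t))
zigzag-inBasis t = σ-perm , σ-tier , short-tier
  where
  σ = zigzag 1 (3 + t)
  σ-length : length σ ≡ 3 + t
  σ-length = zigzag-length 1 (3 + t)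
  σ-perm : IsPerm σ
  σ-perm = consecutive⇒perm σ (subst (λ k → σ ↭ range 1 k) (sym σ-length) (zigzag-↭ 1 (3 + t)))
  σ-tier : revTier σ > t
  σ-tier = zigzag-returns (suc t) (length σ) 1 (subst (suc t ≤_) (sym σ-length) (m≤n+m (suc t) 2))
  short-tier : ∀ τ → IsPerm τ → Contains σ τ → length τ < length σ → revTier τ ≤ t
  short-tier τ τ-perm _ τ<σ =
    ≤-trans (revTier-bound τ τ-perm) (∸-monoˡ-≤ 2 (≤-pred (subst (length τ <_) σ-length τ<σ)))

tier⇒length : ∀ t n → suc t ≤ n ∸ 2 → t + 3 ≤ n
tier⇒length t (suc (suc n)) t<n = subst (_≤ suc (suc n)) (+-comm 3 t) (s≤s (s≤s t<n))

mainTheorem8 : (t : ℕ) →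
    ((σ : List ℕ) → InBasis t σ → t + 3 ≤ length σ) ×
    (∃ λ σ → InBasis t σ × length σ ≡ t + 3)
mainTheorem8 t = lengthBound , (zigzag 1 (3 + t) , zigzag-inBasis t , zigzag-length≡)
  where
  lengthBound : (σ : List ℕ) → InBasis t σ → t + 3 ≤ length σ
  lengthBound σ (σ-perm , σ-tier , _) =
    tier⇒length t (length σ) (≤-trans σ-tier (revTier-bound σ σ-perm))
  zigzag-length≡ : length (zigzag 1 (3 + t)) ≡ t + 3
  zigzag-length≡ = trans (zigzag-length 1 (3 + t)) (+-comm 3 t)
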